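{- Let $\mathrm{MSA}[1..m,1..n]$ be a gapless multiple sequence alignment and let $[x_1..y_1],\dots,[x_b..y_b]$ be the partitioning corresponding to a segmentation $S$ inducing the founder graph $G=(V,E)$ with blocks $V^1,\dots,V^b$. Then $S$ is valid if and only if for every block $V^i$, every $v\in V^i$, every row $1\le t\le m$ and every column $j\neq x_i$, we have $\mathrm{MSA}[t,j..j+|\ell(v)|-1]\neq\ell(v)$.
   Context: A segmentation of the gapless MSA is given by a partition of $[1..n]$ into consecutive intervals $[x_1..y_1],\dots,[x_b..y_b]$ ($x_1=1$, $y_b=n$, $x_k=y_{k-1}+1$). The induced founder graph has blocks $V^k$ consisting of one node per distinct string $\mathrm{MSA}[i,x_k..y_k]$, $1\le i\le m$, labeled $\ell(v)$ by it, and an edge $(v,w)$ with $v\in V^k$, $w\in V^{k+1}$ iff some row $t$ has $\mathrm{MSA}[t,x_k..y_{k+1}]=\ell(v)\ell(w)$. The label of a path is the concatenation of its node labels. $S$ is valid if $G$ is repeat-free, i.e. for every $v\in V$, every occurrence of $\ell(v)$ as a substring of a path label is a prefix of the label of a path starting with $v$. -}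

module Defs where

open import Data.Nat using (ℕ; zero; suc; _+_; _∸_; _≤_)
open import Data.Fin using (Fin)
open import Data.Vec using (Vec; toList)
open import Data.List using (List; []; _∷_; _++_; take; drop; length; concat)
open import Data.Product using (Σ; ∃; ∃-syntax; _×_)
open import Relation.Binary.PropositionalEquality using (_≡_; _≢_)

-- A gapless MSA with m rows and n columns over an alphabet A is  Fin m → Vec A n.
-- Columns are numbered 1..n as in the paper.

-- MSA[t, a..c] (1-based, inclusive), as a list.
sub : {A : Set} {m n : ℕ} → (Fin m → Vec A n) → Fin m → ℕ → ℕ → List A
sub MSA t a c = take (suc c ∸ a) (drop (a ∸ 1) (toList (MSA t)))

-- A segmentation: a partition of [1..n] into consecutive nonempty intervals
-- [x 1 .. y 1], ..., [x b .. y b] (blocks numbered 1..b; values of x, y outside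
-- 1..b are irrelevant).
record Segmentation (n : ℕ) : Set where
  field
    b       : ℕ
    x y     : ℕ → ℕ
    b-pos   : 1 ≤ b
    x-first : x 1 ≡ 1
    y-last  : y b ≡ n
    x-next  : ∀ k → 1 ≤ k → suc k ≤ b → x (suc k) ≡ suc (y k)
    nonempty : ∀ k → 1 ≤ k → k ≤ b → x k ≤ y k

module FounderGraph {A : Set} {m n : ℕ} (MSA : Fin m → Vec A n) (S : Segmentation n) where
  open Segmentation S

  -- A node of block V^k is identified by the pair (k , s) where s is its label ℓ(v):
  -- (k , s) is a node iff 1 ≤ k ≤ b and s = MSA[t, x_k..y_k] for some row t.
  IsNode : ℕ → List A → Set
  IsNode k s = (1 ≤ k) × (k ≤ b) × ∃[ t ] (sub MSA t (x k) (y k) ≡ s)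

  Edge : ℕ → List A → List A → Set
  Edge k s s' = IsNode k s × IsNode (suc k) s'
              × ∃[ t ] (sub MSA t (x k) (y (suc k)) ≡ s ++ s')

  -- PathFrom k ls : ls = ℓ(v₁) ∷ ℓ(v₂) ∷ … is the list of node labels of a
  -- (nonempty) path v₁ v₂ … in G with v₁ ∈ V^k, v₂ ∈ V^(k+1), …
  data PathFrom : ℕ → List (List A) → Set where
    single : ∀ {k s} → IsNode k s → PathFrom k (s ∷ [])
    cons   : ∀ {k s s' ss} → Edge k s s' → PathFrom (suc k) (s' ∷ ss)
           → PathFrom k (s ∷ s' ∷ ss)

  -- Repeat-freeness: for every node v = (k , s), every occurrence of ℓ(v) = s
  -- in the label of a path P (starting at offset o) is the prefix of the label
  -- of a path starting with v: namely P splits as P₁ P₂ where the label of P₁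
  -- has length o and P₂ starts with the node v (block k, label s).
  RepeatFree : Set
  RepeatFree =
    ∀ k s → IsNode k s →
    ∀ k' ls → PathFrom k' ls →
    ∀ o → take (length s) (drop o (concat ls)) ≡ s →
    ∃[ ls₁ ] ∃[ rest ] ((ls ≡ ls₁ ++ (s ∷ rest)) × (length (concat ls₁) ≡ o)
                        × (k' + length ls₁ ≡ k))

  Valid : Set
  Valid = RepeatFree

  NoOffOccurrence : Set
  NoOffOccurrence =
    ∀ k s → IsNode k s →
    ∀ (t : Fin m) (j : ℕ) → 1 ≤ j → j + length s ∸ 1 ≤ n → j ≢ x k →
    sub MSA t j (j + length s ∸ 1) ≢ s

-- Every row is the label of the path through its own blocks, so repeat-freeness forces each
-- occurrence of a node label ℓ(v), v ∈ V^k, inside a row to start at column x_k.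
-- Conversely, if that holds, consider an occurrence of ℓ(v) in a path label that starts inside
-- the first node w, followed by w'.  If it ends within w w', it lies in the row realising that
-- edge, so it starts at x_k; then v and w lie in the same block and the occurrence is w itself.
-- If it reaches beyond w', then ℓ(w') lies inside ℓ(v), hence inside a row, and it is shifted
-- from its block start by exactly as much as ℓ(v) is shifted from x_k, which therefore is zero.
module Submission where

open import Defs
open import Data.Nat using (ℕ; zero; suc; _+_; _∸_; _⊓_; _≤_; _<_; _≤?_; _≟_; z≤n; s≤s)
open import Data.Nat.Properties
open import Data.Fin using (Fin)
open import Data.Vec using (Vec; toList)
open import Data.Vec.Properties using (length-toList)
open import Data.List using (List; []; _∷_; _++_; take; drop; length; concat)
open import Data.List.Properties
  using (length-take; length-drop; length-++; take-take; take-[]; take-all; drop-drop; ++-assoc; ++-identityʳ)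
open import Data.Product using (∃-syntax; _×_; _,_)
open import Data.Sum using (inj₁; inj₂)
open import Data.Empty using (⊥-elim)
open import Relation.Nullary using (yes; no)
open import Relation.Binary.Definitions using (tri<; tri≈; tri>)
open import Relation.Binary.PropositionalEquality
open import Function.Bundles using (_⇔_; mk⇔)

∸-split : ∀ {a c e} → a ≤ c → c ≤ e → c ∸ a + (e ∸ c) ≡ e ∸ a
∸-split {c = c} z≤n       c≤e       = m+[n∸m]≡n c≤e
∸-split         (s≤s a≤c) (s≤s c≤e) = ∸-split a≤c c≤e

suc[m∸1+n]≡m+n : ∀ {m} n → 1 ≤ m → suc (m ∸ 1 + n) ≡ m + n
suc[m∸1+n]≡m+n n (s≤s z≤n) = refl

module _ {A : Set} where

  OccursAt : List A → List A → ℕ → Set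
  OccursAt s l o = take (length s) (drop o l) ≡ s

  take-+ : ∀ p q (l : List A) → take (p + q) l ≡ take p l ++ take q (drop p l)
  take-+ zero    q l       = refl
  take-+ (suc p) q []      = sym (take-[] q)
  take-+ (suc p) q (a ∷ l) = cong (a ∷_) (take-+ p q l)

  take-drop-++ : ∀ {a c e} (l : List A) → a ≤ c → c ≤ e →
                 take (e ∸ a) (drop a l) ≡ take (c ∸ a) (drop a l) ++ take (e ∸ c) (drop c l)
  take-drop-++ {a} {c} {e} l a≤c c≤e = begin
    take (e ∸ a) (drop a l)
      ≡⟨ cong (λ k → take k (drop a l)) (∸-split a≤c c≤e) ⟨
    take (c ∸ a + (e ∸ c)) (drop a l)
      ≡⟨ take-+ (c ∸ a) (e ∸ c) (drop a l) ⟩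
    take (c ∸ a) (drop a l) ++ take (e ∸ c) (drop (c ∸ a) (drop a l))
      ≡⟨ cong (λ v → take (c ∸ a) (drop a l) ++ take (e ∸ c) v) drop-to-c ⟩
    take (c ∸ a) (drop a l) ++ take (e ∸ c) (drop c l) ∎
    where
      open ≡-Reasoning
      drop-to-c : drop (c ∸ a) (drop a l) ≡ drop c l
      drop-to-c = trans (drop-drop a (c ∸ a) l) (cong (λ k → drop k l) (m+[n∸m]≡n a≤c))

  take-length-++ : (w z : List A) → take (length w) (w ++ z) ≡ w
  take-length-++ []      z = refl
  take-length-++ (a ∷ w) z = cong (a ∷_) (take-length-++ w z)

  take-drop-take : ∀ L o M (l : List A) → o + L ≤ M →
                   take L (drop o (take M l)) ≡ take L (drop o l)
  take-drop-take L zero    M       l       le       =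
    trans (take-take L M l) (cong (λ k → take k l) (m≤n⇒m⊓n≡m le))
  take-drop-take L (suc o) (suc M) []      _        = refl
  take-drop-take L (suc o) (suc M) (a ∷ l) (s≤s le) = take-drop-take L o M l le

  occursAt-infix : (p w z : List A) → OccursAt w (p ++ w ++ z) (length p)
  occursAt-infix []      w z = take-length-++ w z
  occursAt-infix (a ∷ p) w z = occursAt-infix p w z

  occursAt-unique : ∀ {s u l o} → OccursAt s l o → OccursAt u l o → length s ≡ length u → s ≡ u
  occursAt-unique {l = l} {o} occ-s occ-u eq =
    trans (sym occ-s) (trans (cong (λ k → take k (drop o l)) eq) occ-u)

  occursAt-bound : ∀ {s l o} → 1 ≤ length s → OccursAt s l o → o + length s ≤ length l
  occursAt-bound {a ∷ s} {l}     {zero}  _ occ = m⊓n≡m⇒m≤n (trans (sym (length-take _ l)) (cong length occ))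
  occursAt-bound {a ∷ s} {b ∷ l} {suc o} _ occ = s≤s (occursAt-bound (s≤s z≤n) occ)

  occursAt-++ˡ : ∀ {s} (x z : List A) {o} → o + length s ≤ length x →
                 OccursAt s (x ++ z) o → OccursAt s x o
  occursAt-++ˡ {s} x z {o} le occ =
    trans (cong (λ l → take (length s) (drop o l)) (sym (take-length-++ x z)))
          (trans (take-drop-take (length s) o (length x) (x ++ z) le) occ)

  occursAt-++ʳ : ∀ {s} (x y : List A) {o} → length x ≤ o →
                 OccursAt s (x ++ y) o → OccursAt s y (o ∸ length x)
  occursAt-++ʳ []      y         _        occ = occ
  occursAt-++ʳ (a ∷ x) y {suc o} (s≤s le) occ = occursAt-++ʳ x y le occ

  occursAt-trans : ∀ {u s l q p} → 1 ≤ length u →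
                   OccursAt u s q → OccursAt s l p → OccursAt u l (p + q)
  occursAt-trans {u} {s} {l} {q} {p} u-nonempty occ-u occ-s = begin
    take (length u) (drop (p + q) l)
      ≡⟨ cong (take (length u)) (drop-drop p q l) ⟨
    take (length u) (drop q (drop p l))
      ≡⟨ take-drop-take (length u) q (length s) (drop p l)
         (occursAt-bound u-nonempty occ-u) ⟨
    take (length u) (drop q (take (length s) (drop p l)))
      ≡⟨ cong (λ v → take (length u) (drop q v)) occ-s ⟩
    take (length u) (drop q s)
      ≡⟨ occ-u ⟩
    u ∎
    where open ≡-Reasoning

  occursAt-inside : ∀ {s u l p q} → OccursAt s l p → OccursAt u l q →
                    p ≤ q → q + length u ≤ p + length s → OccursAt u s (q ∸ p)
  occursAt-inside {s} {u} {l} {p} {q} occ-s occ-u p≤q end≤ = begin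
    take (length u) (drop (q ∸ p) s)
      ≡⟨ cong (λ v → take (length u) (drop (q ∸ p) v)) occ-s ⟨
    take (length u) (drop (q ∸ p) (take (length s) (drop p l)))
      ≡⟨ take-drop-take (length u) (q ∸ p) (length s) (drop p l) fits ⟩
    take (length u) (drop (q ∸ p) (drop p l))
      ≡⟨ cong (take (length u)) (drop-drop p (q ∸ p) l) ⟩
    take (length u) (drop (p + (q ∸ p)) l)
      ≡⟨ cong (λ k → take (length u) (drop k l)) (m+[n∸m]≡n p≤q) ⟩
    take (length u) (drop q l)
      ≡⟨ occ-u ⟩
    u ∎
    where
      open ≡-Reasoning
      fits : q ∸ p + length u ≤ length s
      fits = +-cancelˡ-≤ p _ _ (subst (_≤ p + length s)
               (trans (cong (_+ length u) (sym (m+[n∸m]≡n p≤q))) (+-assoc p (q ∸ p) (length u))) end≤)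

module _ {n : ℕ} (S : Segmentation n) where
  open Segmentation S

  x-pos : ∀ {k} → 1 ≤ k → k ≤ b → 1 ≤ x k
  x-pos {suc zero}    _ _  = ≤-reflexive (sym x-first)
  x-pos {suc (suc k)} _ kb = subst (1 ≤_) (sym (x-next (suc k) (s≤s z≤n) kb)) (s≤s z≤n)

  y<x : ∀ {i j} → 1 ≤ i → i < j → j ≤ b → y i < x j
  y<x {i} {suc j} 1≤i (s≤s i≤j) jb with m≤n⇒m<n∨m≡n i≤j
  ... | inj₂ refl = ≤-reflexive (sym (x-next i 1≤i jb))
  ... | inj₁ i<j  = <-≤-trans (y<x 1≤i i<j j≤b)
                      (≤-trans (nonempty j 1≤j j≤b) (≤-trans (n≤1+n (y j)) (≤-reflexive (sym (x-next j 1≤j jb)))))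
    where
      1≤j = ≤-trans 1≤i (<⇒≤ i<j)
      j≤b = ≤-trans (n≤1+n j) jb

  y-mono : ∀ {i j} → 1 ≤ i → i ≤ j → j ≤ b → y i ≤ y j
  y-mono {i} {j} 1≤i i≤j jb with m≤n⇒m<n∨m≡n i≤j
  ... | inj₂ refl = ≤-refl
  ... | inj₁ i<j  = <⇒≤ (<-≤-trans (y<x 1≤i i<j jb) (nonempty j (≤-trans 1≤i i≤j) jb))

  y≤n : ∀ {k} → 1 ≤ k → k ≤ b → y k ≤ n
  y≤n 1≤k kb = ≤-trans (y-mono 1≤k kb ≤-refl) (≤-reflexive y-last)

  block-unique : ∀ {i j} → 1 ≤ i → i ≤ b → 1 ≤ j → j ≤ b → x j ≤ x i → x i ≤ y j → i ≡ j
  block-unique {i} {j} 1≤i ib 1≤j jb xj≤xi xi≤yj with <-cmp i j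
  ... | tri≈ _ i≡j _ = i≡j
  ... | tri< i<j _ _ =
    ⊥-elim (<-irrefl refl (<-≤-trans (y<x 1≤i i<j jb) (≤-trans xj≤xi (nonempty i 1≤i ib))))
  ... | tri> _ _ j<i = ⊥-elim (<-irrefl refl (<-≤-trans (y<x 1≤j j<i ib) xi≤yj))

module _ {A : Set} {m n : ℕ} (MSA : Fin m → Vec A n) (S : Segmentation n) where
  open Segmentation S
  open FounderGraph MSA S

  row : Fin m → List A
  row t = toList (MSA t)

  length-sub : ∀ t {a c} → 1 ≤ a → c ≤ n → length (sub MSA t a c) ≡ suc c ∸ a
  length-sub t {suc a} {c} _ c≤n = begin
    length (take (c ∸ a) (drop a (row t)))    ≡⟨ length-take (c ∸ a) (drop a (row t)) ⟩
    (c ∸ a) ⊓ length (drop a (row t))         ≡⟨ cong ((c ∸ a) ⊓_) (trans (length-drop a (row t))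
                                                                            (cong (_∸ a) (length-toList (MSA t)))) ⟩
    (c ∸ a) ⊓ (n ∸ a)                         ≡⟨ m≤n⇒m⊓n≡m (∸-monoˡ-≤ a c≤n) ⟩
    c ∸ a                                     ∎
    where open ≡-Reasoning

  sub-occursAt : ∀ t {a c} → 1 ≤ a → c ≤ n → OccursAt (sub MSA t a c) (row t) (a ∸ 1)
  sub-occursAt t {a} 1≤a c≤n = cong (λ k → take k (drop (a ∸ 1) (row t))) (length-sub t 1≤a c≤n)

  sub-++ : ∀ t {a c e} → 1 ≤ a → a ≤ suc c → c ≤ e →
           sub MSA t a e ≡ sub MSA t a c ++ sub MSA t (suc c) e
  sub-++ t {suc a} _ (s≤s a≤c) c≤e = take-drop-++ (row t) a≤c c≤e

  RowFactorAt : ℕ → List A → Set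
  RowFactorAt k u = ∃[ t ] OccursAt u (row t) (x k ∸ 1)

  node-factor : ∀ {k w} → IsNode k w → RowFactorAt k w
  node-factor (1≤k , kb , t , refl) = t , sub-occursAt t (x-pos S 1≤k kb) (y≤n S 1≤k kb)

  edge-factor : ∀ {k w w'} → Edge k w w' → RowFactorAt k (w ++ w')
  edge-factor {k} ((1≤k , kb , _) , (_ , sk≤b , _) , t , eq) =
    t , subst (λ v → OccursAt v (row t) (x k ∸ 1)) eq
              (sub-occursAt t (x-pos S 1≤k kb) (y≤n S (s≤s z≤n) sk≤b))

  length-node : ∀ {k w} → IsNode k w → length w ≡ suc (y k) ∸ x k
  length-node {k} (1≤k , kb , t , refl) = length-sub t (x-pos S 1≤k kb) (y≤n S 1≤k kb)

  node-nonempty : ∀ {k w} → IsNode k w → 1 ≤ length w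
  node-nonempty {k} nw@(1≤k , kb , _) =
    subst (1 ≤_) (sym (length-node nw)) (m<n⇒0<n∸m (s≤s (nonempty k 1≤k kb)))

  node-end : ∀ {k w} → IsNode k w → x k + length w ≡ suc (y k)
  node-end {k} nw@(1≤k , kb , _) =
    trans (cong (x k +_) (length-node nw)) (m+[n∸m]≡n (m≤n⇒m≤1+n (nonempty k 1≤k kb)))

  edge-step : ∀ {k w w'} → Edge k w w' → x k + length w ≡ x (suc k)
  edge-step {k} (nw@(1≤k , _) , (_ , sk≤b , _) , _) = trans (node-end nw) (sym (x-next k 1≤k sk≤b))

  -- p is a 0-based offset into the row, so the occurrence starts at column suc p.
  AlignedOccurrences : Set
  AlignedOccurrences = ∀ k s → IsNode k s → ∀ t p → OccursAt s (row t) p → suc p ≡ x k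

  noOffOccurrence⇒aligned : NoOffOccurrence → AlignedOccurrences
  noOffOccurrence⇒aligned noOff k s ns t p occ with suc p ≟ x k
  ... | yes aligned = aligned
  ... | no  off     = ⊥-elim (noOff k s ns t (suc p) (s≤s z≤n) fits off window)
    where
      -- the window's right end  suc p + length s ∸ 1  reduces to  p + length s
      fits : p + length s ≤ n
      fits = subst (p + length s ≤_) (length-toList (MSA t)) (occursAt-bound (node-nonempty ns) occ)
      window : sub MSA t (suc p) (p + length s) ≡ s
      window = trans (cong (λ L → take L (drop p (row t))) (m+n∸m≡n p (length s))) occ

  aligned⇒noOffOccurrence : AlignedOccurrences → NoOffOccurrence
  aligned⇒noOffOccurrence aligned k s ns t (suc p) _ _ off window = off (aligned k s ns t p occ)
    where
      occ : OccursAt s (row t) p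
      occ = trans (cong (λ L → take L (drop p (row t))) (sym (m+n∸m≡n p (length s)))) window

  aligned-in-factor : AlignedOccurrences → ∀ {k s i u o} → IsNode k s → 1 ≤ x i →
                      RowFactorAt i u → OccursAt s u o → x i + o ≡ x k
  aligned-in-factor aligned {k} {s} {i} {o = o} ns 1≤xi (t , u-in-row) s-in-u =
    trans (sym (suc[m∸1+n]≡m+n o 1≤xi))
          (aligned k s ns t (x i ∸ 1 + o)
                   (occursAt-trans {p = x i ∸ 1} (node-nonempty ns) s-in-u u-in-row))

  path-head : ∀ {i w ws} → PathFrom i (w ∷ ws) → IsNode i w
  path-head (single nw)       = nw
  path-head (cons (nw , _) _) = nw

  first-node-aligned : AlignedOccurrences → ∀ {k s i w ws o} → IsNode k s → PathFrom i (w ∷ ws) →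
                       o < length w → OccursAt s (concat (w ∷ ws)) o → x i + o ≡ x k
  first-node-aligned aligned {s = s} {w = w} {o = o} ns (single nw@(1≤i , ib , _)) _ occ =
    aligned-in-factor aligned ns (x-pos S 1≤i ib) (node-factor nw)
      (subst (λ l → OccursAt s l o) (++-identityʳ w) occ)
  first-node-aligned aligned {k} {s} {i} {w} {w' ∷ ws} {o}
    ns@(1≤k , kb , _) (cons e@((1≤i , ib , _) , nw' , _) _) o<w occ
    with o + length s ≤? length (w ++ w')
  ... | yes within = aligned-in-factor aligned ns (x-pos S 1≤i ib) (edge-factor e)
                       (occursAt-++ˡ (w ++ w') (concat ws) within
                         (subst (λ l → OccursAt s l o) (sym (++-assoc w w' (concat ws))) occ))
  ... | no  beyond = +-cancelʳ-≡ d (x i + o) (x k) (begin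
    x i + o + d     ≡⟨ +-assoc (x i) o d ⟩
    x i + (o + d)   ≡⟨ cong (x i +_) (m+[n∸m]≡n (<⇒≤ o<w)) ⟩
    x i + length w  ≡⟨ edge-step e ⟩
    x (suc i)       ≡⟨ aligned-in-factor aligned nw' (x-pos S 1≤k kb) (node-factor ns) w'-in-s ⟨
    x k + d         ∎)
    where
      open ≡-Reasoning
      d = length w ∸ o
      w'-in-s : OccursAt w' s d
      w'-in-s = occursAt-inside occ (occursAt-infix w w' (concat ws)) (<⇒≤ o<w)
                  (subst (_≤ o + length s) (length-++ w) (<⇒≤ (≰⇒> beyond)))

  node-start : ∀ {i w k s o} → IsNode i w → IsNode k s → o < length w → x i + o ≡ x k → k ≡ i × o ≡ 0
  node-start {i} {w} {k} {s} {o} nw@(1≤i , ib , _) (1≤k , kb , _) o<w start =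
    k≡i , +-cancelˡ-≡ (x i) o 0 (trans start (trans (cong x k≡i) (sym (+-identityʳ (x i)))))
    where
      k≡i : k ≡ i
      k≡i = block-unique S 1≤k kb 1≤i ib (subst (x i ≤_) start (m≤m+n (x i) o))
              (≤-pred (subst (_< suc (y i)) start
                               (<-≤-trans (+-monoʳ-< (x i) o<w) (≤-reflexive (node-end nw)))))

  NodeOccurrence : ℕ → List A → ℕ → List (List A) → ℕ → Set
  NodeOccurrence k s i ls o =
    ∃[ ls₁ ] ∃[ rest ] ((ls ≡ ls₁ ++ (s ∷ rest)) × (length (concat ls₁) ≡ o) × (i + length ls₁ ≡ k))

  nodeOccurrence-here : AlignedOccurrences → ∀ {k s i w ws o} → IsNode k s → PathFrom i (w ∷ ws) →
                        o < length w → OccursAt s (concat (w ∷ ws)) o → NodeOccurrence k s i (w ∷ ws) o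
  nodeOccurrence-here aligned {s = s} {w = w} {ws} ns p o<w occ
    with node-start (path-head p) ns o<w (first-node-aligned aligned ns p o<w occ)
  ... | refl , refl = [] , ws , cong (_∷ ws) (sym s≡w) , refl , +-identityʳ _
    where
      s≡w : s ≡ w
      s≡w = occursAt-unique {l = concat (w ∷ ws)} {o = 0} occ (occursAt-infix [] w (concat ws))
              (trans (length-node ns) (sym (length-node (path-head p))))

  nodeOccurrence-∷ : ∀ {k s i w ws o} → length w ≤ o →
                     NodeOccurrence k s (suc i) ws (o ∸ length w) → NodeOccurrence k s i (w ∷ ws) o
  nodeOccurrence-∷ {i = i} {w} w≤o (ls₁ , rest , refl , len , blk) =
    w ∷ ls₁ , rest , refl , trans (length-++ w) (trans (cong (length w +_) len) (m+[n∸m]≡n w≤o)) ,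
    trans (+-suc i _) blk

  aligned⇒repeatFree : AlignedOccurrences → RepeatFree
  aligned⇒repeatFree aligned k s ns = go
    where
      go : ∀ i ls → PathFrom i ls → ∀ o → OccursAt s (concat ls) o → NodeOccurrence k s i ls o
      go i (w ∷ []) p o occ = nodeOccurrence-here aligned ns p o<w occ
        where
          o<w : o < length w
          o<w = <-≤-trans (m<m+n o (node-nonempty ns))
                  (occursAt-bound (node-nonempty ns) (subst (λ l → OccursAt s l o) (++-identityʳ w) occ))
      go i (w ∷ ws@(_ ∷ _)) p@(cons _ p') o occ with length w ≤? o
      ... | yes w≤o = nodeOccurrence-∷ w≤o
                        (go (suc i) ws p' (o ∸ length w) (occursAt-++ʳ w (concat ws) w≤o occ))
      ... | no  w>o = nodeOccurrence-here aligned ns p (≰⇒> w>o) occ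

  blockLabel : Fin m → ℕ → List A
  blockLabel t k = sub MSA t (x k) (y k)

  blockLabels : Fin m → ℕ → ℕ → List (List A)
  blockLabels t k zero    = []
  blockLabels t k (suc d) = blockLabel t k ∷ blockLabels t (suc k) d

  sub-blockLabel-++ : ∀ t {k e} → 1 ≤ k → suc k ≤ b → y (suc k) ≤ e →
                      sub MSA t (x k) e ≡ blockLabel t k ++ sub MSA t (x (suc k)) e
  sub-blockLabel-++ t {k} {e} 1≤k sk≤b ysk≤e =
    trans (sub-++ t (x-pos S 1≤k kb) (m≤n⇒m≤1+n (nonempty k 1≤k kb))
                    (≤-trans (y-mono S 1≤k (n≤1+n k) sk≤b) ysk≤e))
          (cong (λ a → blockLabel t k ++ sub MSA t a e) (sym (x-next k 1≤k sk≤b)))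
    where kb = ≤-trans (n≤1+n k) sk≤b

  blockLabels-path : ∀ t d {k} → 1 ≤ k → k + d ≤ b → PathFrom k (blockLabels t k (suc d))
  blockLabels-path t zero    {k} 1≤k k≤b = single (1≤k , subst (_≤ b) (+-identityʳ k) k≤b , t , refl)
  blockLabels-path t (suc d) {k} 1≤k k+d≤b =
    cons ((1≤k , ≤-trans (n≤1+n k) sk≤b , t , refl) , (s≤s z≤n , sk≤b , t , refl) , t ,
          sub-blockLabel-++ t 1≤k sk≤b ≤-refl)
         (blockLabels-path t d (s≤s z≤n) sk+d≤b)
    where
      sk+d≤b = subst (_≤ b) (+-suc k d) k+d≤b
      sk≤b = ≤-trans (m≤m+n (suc k) d) sk+d≤b

  concat-blockLabels : ∀ t d {k} → 1 ≤ k → k + d ≤ b →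
                       concat (blockLabels t k (suc d)) ≡ sub MSA t (x k) (y (k + d))
  concat-blockLabels t zero    {k} _ _ =
    trans (++-identityʳ (blockLabel t k)) (cong (λ j → sub MSA t (x k) (y j)) (sym (+-identityʳ k)))
  concat-blockLabels t (suc d) {k} 1≤k k+d≤b = begin
    blockLabel t k ++ concat (blockLabels t (suc k) (suc d))
      ≡⟨ cong (blockLabel t k ++_) (concat-blockLabels t d (s≤s z≤n) sk+d≤b) ⟩
    blockLabel t k ++ sub MSA t (x (suc k)) (y (suc k + d))
      ≡⟨ sub-blockLabel-++ t 1≤k sk≤b (y-mono S (s≤s z≤n) (m≤m+n (suc k) d) sk+d≤b) ⟨
    sub MSA t (x k) (y (suc k + d))                          ≡⟨ cong (λ j → sub MSA t (x k) (y j)) (+-suc k d) ⟨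
    sub MSA t (x k) (y (k + suc d))                          ∎
    where
      open ≡-Reasoning
      sk+d≤b = subst (_≤ b) (+-suc k d) k+d≤b
      sk≤b = ≤-trans (m≤m+n (suc k) d) sk+d≤b

  row-path : ∀ t → ∃[ ls ] (PathFrom 1 ls × concat ls ≡ row t)
  row-path t = blockLabels t 1 (suc d) , blockLabels-path t d ≤-refl 1+d≤b , (begin
    concat (blockLabels t 1 (suc d)) ≡⟨ concat-blockLabels t d ≤-refl 1+d≤b ⟩
    sub MSA t (x 1) (y (1 + d))      ≡⟨ cong₂ (sub MSA t) x-first (trans (cong y 1+d≡b) y-last) ⟩
    take n (row t)                   ≡⟨ take-all n (row t) (≤-reflexive (length-toList (MSA t))) ⟩
    row t                            ∎)
    where
      open ≡-Reasoning
      d = b ∸ 1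
      1+d≡b : 1 + d ≡ b
      1+d≡b = m+[n∸m]≡n b-pos
      1+d≤b = ≤-reflexive 1+d≡b

  path-uncons : ∀ {i w s rest} ls₁ → PathFrom i (w ∷ ls₁ ++ s ∷ rest) →
                x i + length w ≡ x (suc i) × PathFrom (suc i) (ls₁ ++ s ∷ rest)
  path-uncons []      (cons e p) = edge-step e , p
  path-uncons (_ ∷ _) (cons e p) = edge-step e , p

  path-offset : ∀ {i s rest} ls₁ → PathFrom i (ls₁ ++ s ∷ rest) →
                x i + length (concat ls₁) ≡ x (i + length ls₁)
  path-offset {i} []        _ = trans (+-identityʳ (x i)) (cong x (sym (+-identityʳ i)))
  path-offset {i} (w ∷ ls₁) p with path-uncons ls₁ p
  ... | step , p' = begin
    x i + length (w ++ concat ls₁)          ≡⟨ cong (x i +_) (length-++ w) ⟩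
    x i + (length w + length (concat ls₁))  ≡⟨ +-assoc (x i) (length w) _ ⟨
    x i + length w + length (concat ls₁)    ≡⟨ cong (_+ length (concat ls₁)) step ⟩
    x (suc i) + length (concat ls₁)         ≡⟨ path-offset ls₁ p' ⟩
    x (suc i + length ls₁)                  ≡⟨ cong x (+-suc i (length ls₁)) ⟨
    x (i + length (w ∷ ls₁))                ∎
    where open ≡-Reasoning

  valid⇒aligned : Valid → AlignedOccurrences
  valid⇒aligned valid k s ns t p occ with row-path t
  ... | ls , path , concat≡row
    with valid k s ns 1 ls path p (subst (λ l → OccursAt s l p) (sym concat≡row) occ)
  ... | ls₁ , rest , refl , len , blk = begin
    suc p                      ≡⟨ cong (_+ p) x-first ⟨
    x 1 + p                    ≡⟨ cong (x 1 +_) len ⟨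
    x 1 + length (concat ls₁)  ≡⟨ path-offset ls₁ path ⟩
    x (1 + length ls₁)         ≡⟨ cong x blk ⟩
    x k                        ∎
    where open ≡-Reasoning

lemma3 : {A : Set} (m n : ℕ) (MSA : Fin m → Vec A n) (S : Segmentation n) →
         FounderGraph.Valid MSA S ⇔ FounderGraph.NoOffOccurrence MSA S
lemma3 m n MSA S = mk⇔
  (λ valid → aligned⇒noOffOccurrence MSA S (valid⇒aligned MSA S valid))
  (λ noOff → aligned⇒repeatFree MSA S (noOffOccurrence⇒aligned MSA S noOff))
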